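{- Let $\sigma$ be a simple permutation of length $m\ge 4$ avoiding $2341$ and $4123$, and let $\alpha_1,\dots,\alpha_m$ be nonempty permutations. Then the inflation $\sigma[\alpha_1,\dots,\alpha_m]$ avoids $2341$ and $4123$ if and only if every $\alpha_i$ is a decreasing permutation.
   Context: A permutation $\pi$ avoids $\tau$ if it has no subsequence order-isomorphic to $\tau$. An interval of $\pi$ is a contiguous subsequence whose values form a set of consecutive integers; $\pi$ is simple if its only intervals are itself and singletons. The inflation $\sigma[\alpha_1,\dots,\alpha_m]$ is the permutation of length $|\alpha_1|+\dots+|\alpha_m|$ which is a concatenation $\alpha_1'\alpha_2'\cdots\alpha_m'$ of intervals with each $\alpha_i'$ order-isomorphic to $\alpha_i$, such that any choice of one entry $a_i$ from each $\alpha_i'$ gives a sequence $a_1\cdots a_m$ order-isomorphic to $\sigma$. -}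

module Defs where

open import Data.Nat using (ℕ; zero; suc; _+_; _∸_; _≤_; _<_; _<?_)
open import Data.Fin using (Fin; toℕ)
open import Data.Fin.Permutation using (Permutation′; _⟨$⟩ʳ_)
open import Data.Nat.ListAction using (sum)
open import Data.List using (List; map; concatMap; allFin; length; lookup)
open import Data.Vec using (Vec; []; _∷_)
import Data.Vec as Vec
open import Data.Sum using (_⊎_)
open import Data.Bool using (if_then_else_)
open import Data.Product using (Σ; _×_; ∃)
open import Function.Bundles using (_⇔_)
open import Relation.Nullary using (¬_)
open import Relation.Nullary.Decidable using (⌊_⌋)
open import Relation.Binary.PropositionalEquality using (_≡_)

Word : ℕ → Set
Word L = Fin L → ℕ

word : ∀ {n} → Permutation′ n → Word n
word π i = toℕ (π ⟨$⟩ʳ i)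

Contains : ∀ {k L} → Word k → Word L → Set
Contains {k} {L} p w =
  Σ (Fin k → Fin L) λ f →
    (∀ a b → toℕ a < toℕ b → toℕ (f a) < toℕ (f b)) ×
    (∀ a b → (p a < p b) ⇔ (w (f a) < w (f b)))

Avoids : ∀ {k L} → Word k → Word L → Set
Avoids p w = ¬ Contains p w

p2341 : Word 4
p2341 i = Vec.lookup (2 ∷ 3 ∷ 4 ∷ 1 ∷ []) i

p4123 : Word 4
p4123 i = Vec.lookup (4 ∷ 1 ∷ 2 ∷ 3 ∷ []) i

IsInterval : ∀ {n} → Permutation′ n → Fin n → Fin n → Set
IsInterval {n} π a b =
  toℕ a ≤ toℕ b ×
  ∃ λ c → ∀ v →
    (c ≤ v × v < c + suc (toℕ b ∸ toℕ a)) ⇔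
    (∃ λ (p : Fin n) → toℕ a ≤ toℕ p × toℕ p ≤ toℕ b × word π p ≡ v)

IsSimple : ∀ {n} → Permutation′ n → Set
IsSimple {n} π = ∀ a b → IsInterval π a b →
  (toℕ a ≡ toℕ b) ⊎ (toℕ a ≡ 0 × suc (toℕ b) ≡ n)

IsDecreasing : ∀ {n} → Permutation′ n → Set
IsDecreasing π = ∀ i j → toℕ i < toℕ j → word π j < word π i

-- Inflation σ[α₁,…,αₘ]: block i (in left-to-right order) consists of the values
-- offset i + αᵢ(j), where offset i = Σ { |α_l| : σ(l) < σ(i) }.
-- Values are 0-based, so the result is literally a permutation of 0..N-1,
-- N = Σ |αᵢ|, given as a list.
offset : ∀ {m} (σ : Permutation′ m) (k : Fin m → ℕ) → Fin m → ℕ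
offset {m} σ k i =
  sum (map (λ l → if ⌊ word σ l <? word σ i ⌋ then k l else 0) (allFin m))

inflationList : ∀ {m} (σ : Permutation′ m) (k : Fin m → ℕ)
  (α : (i : Fin m) → Permutation′ (k i)) → List ℕ
inflationList {m} σ k α =
  concatMap (λ i → map (λ j → offset σ k i + word (α i) j) (allFin (k i))) (allFin m)

inflation : ∀ {m} (σ : Permutation′ m) (k : Fin m → ℕ)
  (α : (i : Fin m) → Permutation′ (k i)) → Word (length (inflationList σ k α))
inflation σ k α = lookup (inflationList σ k α)

module Submission where

-- If every αᵢ is decreasing, an occurrence of 2341 or 4123 in σ[α] uses each block at most once:
-- its ascents cross blocks, and the 4 and the 1 cannot share a block since the 2 would then lie
-- below the 1. So it collapses to an occurrence in σ. Conversely, an ascent in αₓ yields a 2341 or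
-- a 4123 as soon as x plays the 2 or the 3 of a 231, or the 1 or the 2 of a 312, in σ. If x played
-- none of these roles, the largest segment around x whose entries left of x lie above x and whose
-- entries right of x lie below x would be an interval, and simplicity would force σ to be a direct
-- or a skew sum split next to x, which no simple permutation of length at least 3 is.

open import Defs
open import Data.Bool using (if_then_else_)
open import Data.Empty using (⊥; ⊥-elim)
open import Data.Fin using (Fin; zero; suc; toℕ; fromℕ; fromℕ<; inject₁; #_)
open import Data.Fin.Permutation using (Permutation′; _⟨$⟩ʳ_; _⟨$⟩ˡ_; inverseˡ; inverseʳ)
open import Data.Fin.Properties
  using (toℕ-injective; toℕ<n; toℕ-fromℕ; toℕ-fromℕ<; any?; all?; pigeonhole)
  renaming (<⇒≢ to <⇒≢ᶠ)
open import Data.List using (List; []; _∷_; _++_; concat; tabulate; map; allFin; length; lookup)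
open import Data.List.Membership.Propositional using (_∈_)
open import Data.List.Membership.Propositional.Properties using (∈-allFin)
open import Data.List.Properties using (length-tabulate; map-tabulate; tabulate-cong)
open import Data.List.Relation.Unary.Any using (here; there)
open import Data.Nat using (ℕ; zero; suc; _+_; _∸_; _≤_; _<_; _>_; _≤?_; _<?_; z≤n; s≤s; s≤s⁻¹)
open import Data.Nat.ListAction using (sum)
open import Data.Nat.Properties
open import Data.Product using (∃; ∃₂; _×_; _,_; proj₁; proj₂)
open import Data.Sum using (_⊎_; inj₁; inj₂; [_,_]′)
open import Data.Vec as Vec using ([]; _∷_)
open import Function using (_∘_; id)
open import Function.Bundles using (_⇔_; mk⇔; Equivalence)
open import Relation.Binary using (TotalPreorder; Transitive; tri<; tri≈; tri>)
import Relation.Binary.Construct.Flip.EqAndOrd as Flip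
open import Relation.Binary.PropositionalEquality
  using (_≡_; _≢_; refl; sym; trans; cong; cong₂; subst; subst₂; module ≡-Reasoning)
open import Relation.Nullary using (¬_; Dec; yes; no; contradiction)
open import Relation.Nullary.Decidable
  using (⌊_⌋; True; toWitness; decidable-stable; _×-dec_; _→-dec_)
open import Relation.Unary using (Pred; Decidable)

module _ {n} (π : Permutation′ n) where

  word-injective : ∀ {i j} → word π i ≡ word π j → i ≡ j
  word-injective {i} {j} eq = begin
    i                  ≡⟨ inverseˡ π ⟨
    π ⟨$⟩ˡ (π ⟨$⟩ʳ i)  ≡⟨ cong (π ⟨$⟩ˡ_) (toℕ-injective eq) ⟩
    π ⟨$⟩ˡ (π ⟨$⟩ʳ j)  ≡⟨ inverseˡ π ⟩
    j                  ∎
    where open ≡-Reasoning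

  word-surjective : ∀ {v} → v < n → ∃ λ i → word π i ≡ v
  word-surjective v<n = π ⟨$⟩ˡ fromℕ< v<n , trans (cong toℕ (inverseʳ π)) (toℕ-fromℕ< v<n)

  word<n : ∀ i → word π i < n
  word<n i = toℕ<n (π ⟨$⟩ʳ i)

  word-≮⇒> : ∀ {i j} → i ≢ j → ¬ word π i < word π j → word π j < word π i
  word-≮⇒> i≢j ≮ = ≤∧≢⇒< (≮⇒≥ ≮) (i≢j ∘ word-injective ∘ sym)

Ascending : ∀ {k} → (Fin (suc k) → ℕ) → Set
Ascending {k} h = (i : Fin k) → h (inject₁ i) < h (suc i)

ascending₄ : {h : Fin 4 → ℕ} → h (# 0) < h (# 1) → h (# 1) < h (# 2) → h (# 2) < h (# 3) →
  Ascending h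
ascending₄ h₀ h₁ h₂ zero             = h₀
ascending₄ h₀ h₁ h₂ (suc zero)       = h₁
ascending₄ h₀ h₁ h₂ (suc (suc zero)) = h₂

ascending⇒increasing : ∀ {k} {h : Fin (suc k) → ℕ} → Ascending h →
  ∀ a b → toℕ a < toℕ b → h a < h b
ascending⇒increasing         asc zero    (suc zero)    _   = asc zero
ascending⇒increasing {suc k} {h} asc zero (suc (suc b)) _ =
  <-trans (asc zero) (ascending⇒increasing {h = h ∘ suc} (asc ∘ suc) zero (suc b) (s≤s z≤n))
ascending⇒increasing {suc k} {h} asc (suc a) (suc b) a<b =
  ascending⇒increasing {h = h ∘ suc} (asc ∘ suc) a b (s≤s⁻¹ a<b)

contains-by-preservation : ∀ {k L} {p : Word k} {w : Word L} → (∀ a b → p a ≡ p b → a ≡ b) →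
  (f : Fin k → Fin L) → (∀ a b → toℕ a < toℕ b → toℕ (f a) < toℕ (f b)) →
  (∀ a b → p a < p b → w (f a) < w (f b)) → Contains p w
contains-by-preservation {p = p} {w} p-injective f f-increasing preserves =
  f , f-increasing , λ a b → mk⇔ (preserves a b) (reflects a b)
  where
  reflects : ∀ a b → w (f a) < w (f b) → p a < p b
  reflects a b wa<wb with <-cmp (p a) (p b)
  ... | tri< pa<pb _ _ = pa<pb
  ... | tri≈ _ pa≡pb _ = contradiction (cong (w ∘ f) (p-injective a b pa≡pb)) (<⇒≢ wa<wb)
  ... | tri> _ _ pb<pa = contradiction (preserves b a pb<pa) (<⇒≯ wa<wb)

-- A pattern with values 1..k+1, listed by `order` from its smallest to its largest value.
record Ranking {k} (p : Word (suc k)) : Set where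
  field
    rank order : Fin (suc k) → Fin (suc k)
    p≡1+rank   : ∀ a → p a ≡ suc (toℕ (rank a))
    order∘rank : ∀ a → order (rank a) ≡ a

  injective : ∀ a b → p a ≡ p b → a ≡ b
  injective a b pa≡pb = begin
    a              ≡⟨ order∘rank a ⟨
    order (rank a) ≡⟨ cong order (toℕ-injective (suc-injective rank-eq)) ⟩
    order (rank b) ≡⟨ order∘rank b ⟩
    b              ∎
    where
    open ≡-Reasoning
    rank-eq : suc (toℕ (rank a)) ≡ suc (toℕ (rank b))
    rank-eq = trans (sym (p≡1+rank a)) (trans pa≡pb (p≡1+rank b))

  preserves : ∀ {h : Fin (suc k) → ℕ} → Ascending (h ∘ order) → ∀ a b → p a < p b → h a < h b
  preserves {h} asc a b pa<pb =
    subst₂ (λ a′ b′ → h a′ < h b′) (order∘rank a) (order∘rank b)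
      (ascending⇒increasing {h = h ∘ order} asc (rank a) (rank b)
        (s≤s⁻¹ (subst₂ _<_ (p≡1+rank a) (p≡1+rank b) pa<pb)))

  contains : ∀ {L} {w : Word L} (f : Fin (suc k) → Fin L) →
    Ascending (toℕ ∘ f) → Ascending (w ∘ f ∘ order) → Contains p w
  contains {w = w} f positions values =
    contains-by-preservation {w = w} injective f (ascending⇒increasing {h = toℕ ∘ f} positions)
      (preserves {h = w ∘ f} values)

contains₄ : ∀ {L} {p : Word 4} {w : Word L} (R : Ranking p) (f : Fin 4 → Fin L) →
  let open Ranking R using (order) in
  toℕ (f (# 0)) < toℕ (f (# 1)) → toℕ (f (# 1)) < toℕ (f (# 2)) → toℕ (f (# 2)) < toℕ (f (# 3)) →
  w (f (order (# 0))) < w (f (order (# 1))) → w (f (order (# 1))) < w (f (order (# 2))) →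
  w (f (order (# 2))) < w (f (order (# 3))) → Contains p w
contains₄ {w = w} R f f₀<f₁ f₁<f₂ f₂<f₃ v₀<v₁ v₁<v₂ v₂<v₃ = Ranking.contains R {w = w} f
  (ascending₄ {h = toℕ ∘ f} f₀<f₁ f₁<f₂ f₂<f₃)
  (ascending₄ {h = w ∘ f ∘ Ranking.order R} v₀<v₁ v₁<v₂ v₂<v₃)

ranking-2341 : Ranking p2341
ranking-2341 = record
  { rank       = Vec.lookup (# 1 ∷ # 2 ∷ # 3 ∷ # 0 ∷ [])
  ; order      = Vec.lookup (# 3 ∷ # 0 ∷ # 1 ∷ # 2 ∷ [])
  ; p≡1+rank   = λ { zero → refl ; (suc zero) → refl ; (suc (suc zero)) → refl
                   ; (suc (suc (suc zero))) → refl }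
  ; order∘rank = λ { zero → refl ; (suc zero) → refl ; (suc (suc zero)) → refl
                   ; (suc (suc (suc zero))) → refl }
  }

ranking-4123 : Ranking p4123
ranking-4123 = record
  { rank       = Vec.lookup (# 3 ∷ # 0 ∷ # 1 ∷ # 2 ∷ [])
  ; order      = Vec.lookup (# 1 ∷ # 2 ∷ # 3 ∷ # 0 ∷ [])
  ; p≡1+rank   = λ { zero → refl ; (suc zero) → refl ; (suc (suc zero)) → refl
                   ; (suc (suc (suc zero))) → refl }
  ; order∘rank = λ { zero → refl ; (suc zero) → refl ; (suc (suc zero)) → refl
                   ; (suc (suc (suc zero))) → refl }
  }

module _ {c ℓ₁ ℓ₂} (O : TotalPreorder c ℓ₁ ℓ₂) where
  open TotalPreorder O using (_≲_; total) renaming (Carrier to A; refl to ≲-refl; trans to ≲-trans)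

  extremum : ∀ {n p} (f : Fin n → A) {P : Pred (Fin n) p} → Decidable P → ∃ P →
    ∃ λ e → P e × (∀ q → P q → f e ≲ f q)
  extremum {suc n} f P? witness with P? zero | any? (P? ∘ suc)
  ... | yes P0 | no ¬tail = zero , P0 , λ where
    zero    _  → ≲-refl
    (suc q) Pq → contradiction (q , Pq) ¬tail
  ... | yes P0 | yes tail with extremum (f ∘ suc) (P? ∘ suc) tail
  ...   | e , Pe , e-least with total (f zero) (f (suc e))
  ...     | inj₁ f0≲ = zero , P0 , λ where
    zero    _  → ≲-refl
    (suc q) Pq → ≲-trans f0≲ (e-least q Pq)
  ...     | inj₂ ≲f0 = suc e , Pe , λ where
    zero    _  → ≲f0
    (suc q) Pq → e-least q Pq
  extremum {suc n} f P? (zero  , P0) | no ¬P0 | _ = contradiction P0 ¬P0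
  extremum {suc n} f P? (suc q , Pq) | no ¬P0 | _ with extremum (f ∘ suc) (P? ∘ suc) (q , Pq)
  ... | e , Pe , e-least = suc e , Pe , λ where
    zero    P0 → contradiction P0 ¬P0
    (suc q) Pq → e-least q Pq

argmin : ∀ {n p} (f : Fin n → ℕ) {P : Pred (Fin n) p} → Decidable P → ∃ P →
  ∃ λ e → P e × (∀ q → P q → f e ≤ f q)
argmin = extremum ≤-totalPreorder

argmax : ∀ {n p} (f : Fin n → ℕ) {P : Pred (Fin n) p} → Decidable P → ∃ P →
  ∃ λ e → P e × (∀ q → P q → f q ≤ f e)
argmax = extremum (Flip.totalPreorder ≤-totalPreorder)

_∈[_,_] : ∀ {n} → Fin n → Fin n → Fin n → Set
p ∈[ a , b ] = toℕ a ≤ toℕ p × toℕ p ≤ toℕ b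

_∈?[_,_] : ∀ {n} (p a b : Fin n) → Dec (p ∈[ a , b ])
p ∈?[ a , b ] = (toℕ a ≤? toℕ p) ×-dec (toℕ p ≤? toℕ b)

Separated : ∀ {n} → Permutation′ n → Fin n → Fin n → Set
Separated π a b = ∀ q → toℕ q < toℕ a ⊎ toℕ b < toℕ q →
  (∀ p → p ∈[ a , b ] → word π q < word π p) ⊎ (∀ p → p ∈[ a , b ] → word π p < word π q)

module _ {n} (π : Permutation′ n) {a b : Fin n} (a≤b : toℕ a ≤ toℕ b)
         (separated : Separated π a b) where

  private
    s : Fin n → ℕ
    s = word π

    len : ℕ
    len = suc (toℕ b ∸ toℕ a)

    outside : ∀ {q} → ¬ q ∈[ a , b ] → toℕ q < toℕ a ⊎ toℕ b < toℕ q
    outside {q} q∉ with toℕ a ≤? toℕ q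
    ... | yes a≤q = inj₂ (≰⇒> (q∉ ∘ (a≤q ,_)))
    ... | no  a≰q = inj₁ (≰⇒> a≰q)

    minimum : ∃ λ p → p ∈[ a , b ] × (∀ q → q ∈[ a , b ] → s p ≤ s q)
    minimum = argmin s (_∈?[ a , b ]) (a , ≤-refl , a≤b)

    c : ℕ
    c = s (proj₁ minimum)

    c≤ : ∀ p → p ∈[ a , b ] → c ≤ s p
    c≤ = proj₂ (proj₂ minimum)

    convex : ∀ {v p} → p ∈[ a , b ] → c ≤ v → v ≤ s p → ∃ λ p′ → p′ ∈[ a , b ] × s p′ ≡ v
    convex {v} {p} p∈ c≤v v≤sp with word-surjective π (≤-<-trans v≤sp (word<n π p))
    ... | q , sq≡v with q ∈?[ a , b ]
    ...   | yes q∈ = q , q∈ , sq≡v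
    ...   | no  q∉ with separated q (outside q∉)
    ...     | inj₁ below = contradiction (subst (c ≤_) (sym sq≡v) c≤v)
                             (<⇒≱ (below _ (proj₁ (proj₂ minimum))))
    ...     | inj₂ above = contradiction (subst (_≤ s p) (sym sq≡v) v≤sp) (<⇒≱ (above p p∈))

    index< : ∀ {p} → p ∈[ a , b ] → toℕ p ∸ toℕ a < len
    index< (_ , p≤b) = s≤s (∸-monoˡ-≤ (toℕ a) p≤b)

    index : ∀ {p} → p ∈[ a , b ] → Fin len
    index p∈ = fromℕ< (index< p∈)

    index-injective : ∀ {p p′} (p∈ : p ∈[ a , b ]) (p′∈ : p′ ∈[ a , b ]) →
      index p∈ ≡ index p′∈ → p ≡ p′
    index-injective p∈ p′∈ eq = toℕ-injective (∸-cancelʳ-≡ (proj₁ p∈) (proj₁ p′∈)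
      (trans (sym (toℕ-fromℕ< (index< p∈))) (trans (cong toℕ eq) (toℕ-fromℕ< (index< p′∈)))))

    a+i≤b : (i : Fin len) → toℕ a + toℕ i ≤ toℕ b
    a+i≤b i = ≤-trans (+-monoʳ-≤ (toℕ a) (s≤s⁻¹ (toℕ<n i))) (≤-reflexive (m+[n∸m]≡n a≤b))

    position : Fin len → Fin n
    position i = fromℕ< (≤-<-trans (a+i≤b i) (toℕ<n b))

    toℕ-position : ∀ i → toℕ (position i) ≡ toℕ a + toℕ i
    toℕ-position i = toℕ-fromℕ< (≤-<-trans (a+i≤b i) (toℕ<n b))

    position∈ : ∀ i → position i ∈[ a , b ]
    position∈ i = subst (toℕ a ≤_) (sym (toℕ-position i)) (m≤m+n _ _)
                , subst (_≤ toℕ b) (sym (toℕ-position i)) (a+i≤b i)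

    -- len + 1 values c, c+1, …, c+len would all be attained inside the segment.
    values-below : ∀ p → p ∈[ a , b ] → s p < c + len
    values-below p p∈ with s p <? c + len
    ... | yes below = below
    ... | no  ≮ = ⊥-elim (collision (pigeonhole (n<1+n len) (λ u → index (attained∈ u))))
      where
      attained : (u : Fin (suc len)) → ∃ λ p′ → p′ ∈[ a , b ] × s p′ ≡ c + toℕ u
      attained u = convex p∈ (m≤m+n c (toℕ u)) (≤-trans (+-monoʳ-≤ c (s≤s⁻¹ (toℕ<n u))) (≮⇒≥ ≮))
      attained∈ : ∀ u → proj₁ (attained u) ∈[ a , b ]
      attained∈ u = proj₁ (proj₂ (attained u))
      collision : ∃₂ (λ u u′ → toℕ u < toℕ u′ × index (attained∈ u) ≡ index (attained∈ u′)) → ⊥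
      collision (u , u′ , u<u′ , same-index) = <⇒≢ u<u′ (+-cancelˡ-≡ c _ _ (begin
        c + toℕ u                ≡⟨ proj₂ (proj₂ (attained u)) ⟨
        s (proj₁ (attained u))
          ≡⟨ cong s (index-injective (attained∈ u) (attained∈ u′) same-index) ⟩
        s (proj₁ (attained u′))  ≡⟨ proj₂ (proj₂ (attained u′)) ⟩
        c + toℕ u′               ∎))
        where open ≡-Reasoning

    -- If all len inside values were below v, they would fit into the v ∸ c < len slots [c, v).
    values-attained : ∀ v → c ≤ v → v < c + len → ∃ λ p → p ∈[ a , b ] × s p ≡ v
    values-attained v c≤v v<c+len with any? (λ p → p ∈?[ a , b ] ×-dec (v ≤? s p))
    ... | yes (p , p∈ , v≤sp) = convex p∈ c≤v v≤sp
    ... | no  none = ⊥-elim (collision (pigeonhole (m<n+o⇒m∸n<o v c v<c+len) slot))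
      where
      slot< : ∀ i → s (position i) ∸ c < v ∸ c
      slot< i = ∸-monoˡ-< (≰⇒> λ v≤ → none (position i , position∈ i , v≤)) (c≤ _ (position∈ i))
      slot : Fin len → Fin (v ∸ c)
      slot i = fromℕ< (slot< i)
      collision : ∃₂ (λ i i′ → toℕ i < toℕ i′ × slot i ≡ slot i′) → ⊥
      collision (i , i′ , i<i′ , same-slot) = <⇒≢ i<i′ (+-cancelˡ-≡ (toℕ a) _ _
          (trans (sym (toℕ-position i))
            (trans (cong toℕ (word-injective π same-value)) (toℕ-position i′))))
        where
        same-value : s (position i) ≡ s (position i′)
        same-value = ∸-cancelʳ-≡ (c≤ _ (position∈ i)) (c≤ _ (position∈ i′))
          (trans (sym (toℕ-fromℕ< (slot< i))) (trans (cong toℕ same-slot) (toℕ-fromℕ< (slot< i′))))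

  separated⇒interval : IsInterval π a b
  separated⇒interval = a≤b , c , λ v → mk⇔
    (λ (c≤v , v<) → let (p , (a≤p , p≤b) , sp≡v) = values-attained v c≤v v< in p , a≤p , p≤b , sp≡v)
    (λ (p , a≤p , p≤b , sp≡v) → subst (c ≤_) sp≡v (c≤ p (a≤p , p≤b))
                              , subst (_< c + len) sp≡v (values-below p (a≤p , p≤b)))

-- Positions ≤ e and positions > e form two blocks whose values are ordered by _≺_:
-- π is a direct sum (_≺_ = _<_) or a skew sum (_≺_ = _>_) with the cut after e.
CutAt : (ℕ → ℕ → Set) → ∀ {n} → Permutation′ n → ℕ → Set
CutAt _≺_ π e = ∀ q r → toℕ q ≤ e → e < toℕ r → word π q ≺ word π r

simple⇒no-cut : ∀ {n} (π : Permutation′ n) → IsSimple π → 3 ≤ n → ∀ {e} → suc e < n →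
  CutAt _<_ π e ⊎ CutAt _>_ π e → ⊥
simple⇒no-cut {suc n} π simple 3≤n {e} e+1<n cut =
  conclude (simple zero last (separated⇒interval π z≤n prefix-separated))
           (simple first (fromℕ n) (separated⇒interval π first≤end suffix-separated))
  where
  e<1+n : e < suc n
  e<1+n = <-trans (n<1+n e) e+1<n
  last first : Fin (suc n)
  last  = fromℕ< e<1+n
  first = fromℕ< e+1<n
  toℕ-last : toℕ last ≡ e
  toℕ-last = toℕ-fromℕ< e<1+n
  toℕ-first : toℕ first ≡ suc e
  toℕ-first = toℕ-fromℕ< e+1<n

  first≤end : toℕ first ≤ toℕ (fromℕ n)
  first≤end = subst₂ _≤_ (sym toℕ-first) (sym (toℕ-fromℕ n)) (s≤s⁻¹ e+1<n)

  prefix-separated : Separated π zero last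
  prefix-separated q (inj₂ last<q) =
    [ (λ direct → inj₂ λ p (_ , p≤last) → direct p q (p≤e p≤last) e<q)
    , (λ skew   → inj₁ λ p (_ , p≤last) → skew p q (p≤e p≤last) e<q) ]′ cut
    where
    e<q = subst (_< toℕ q) toℕ-last last<q
    p≤e : ∀ {p} → toℕ p ≤ toℕ last → toℕ p ≤ e
    p≤e {p} = subst (toℕ p ≤_) toℕ-last

  suffix-separated : Separated π first (fromℕ n)
  suffix-separated q (inj₂ end<q) =
    contradiction (subst (_< toℕ q) (toℕ-fromℕ n) end<q) (≤⇒≯ (s≤s⁻¹ (toℕ<n q)))
  suffix-separated q (inj₁ q<first) =
    [ (λ direct → inj₁ λ p (first≤p , _) → direct q p q≤e (e<p first≤p))
    , (λ skew   → inj₂ λ p (first≤p , _) → skew q p q≤e (e<p first≤p)) ]′ cut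
    where
    q≤e = s≤s⁻¹ (subst (toℕ q <_) toℕ-first q<first)
    e<p : ∀ {p} → toℕ first ≤ toℕ p → e < toℕ p
    e<p {p} = subst (_≤ toℕ p) toℕ-first

  conclude : toℕ (zero {suc n}) ≡ toℕ last ⊎ (toℕ (zero {suc n}) ≡ 0 × suc (toℕ last) ≡ suc n) →
             toℕ first ≡ toℕ (fromℕ n) ⊎ (toℕ first ≡ 0 × suc (toℕ (fromℕ n)) ≡ suc n) → ⊥
  conclude (inj₂ (_ , whole)) _ = <-irrefl (trans (sym (cong suc toℕ-last)) whole) e+1<n
  conclude _ (inj₂ (first≡0 , _)) = 0≢1+n (trans (sym first≡0) toℕ-first)
  conclude (inj₁ 0≡last) (inj₁ first≡end) =
    contradiction (subst (λ z → 3 ≤ suc z) n≡1 3≤n) λ { (s≤s (s≤s ())) }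
    where
    n≡1 : n ≡ 1
    n≡1 = trans (sym (toℕ-fromℕ n))
            (trans (sym first≡end) (trans toℕ-first (cong suc (trans (sym toℕ-last) (sym 0≡last)))))

pivot⇒cut : ∀ {n} (π : Permutation′ n) {_≺_ : ℕ → ℕ → Set} → Transitive _≺_ → 2 ≤ n → ∀ x →
  (∀ q → toℕ q < toℕ x → word π q ≺ word π x) → (∀ r → toℕ x < toℕ r → word π x ≺ word π r) →
  ∃ λ e → suc e < n × CutAt _≺_ π e
pivot⇒cut π {_≺_} ≺-trans 2≤n zero left right = 0 , 2≤n , λ q r q≤0 0<r →
  subst (λ z → word π z ≺ word π r) (sym (toℕ-injective (n≤0⇒n≡0 q≤0))) (right r 0<r)
pivot⇒cut π {_≺_} ≺-trans 2≤n (suc x) left right = toℕ x , toℕ<n (suc x) , cut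
  where
  cut : CutAt _≺_ π (toℕ x)
  cut q r q≤x x<r with m≤n⇒m<n∨m≡n x<r
  ... | inj₁ x+1<r = ≺-trans (left q (s≤s q≤x)) (right r x+1<r)
  ... | inj₂ x+1≡r = subst (λ z → word π q ≺ word π z) (toℕ-injective x+1≡r) (left q (s≤s q≤x))

-- The roles of an entry x in a 231 or a 312 of π for which inflating x by an ascent
-- creates a 2341 or a 4123.
data Role231or312 {n} (π : Permutation′ n) (x : Fin n) : Set where
  two-of-231   : ∀ {q r} → toℕ x < toℕ q → toℕ q < toℕ r →
                 word π r < word π x → word π x < word π q → Role231or312 π x
  three-of-231 : ∀ {q r} → toℕ q < toℕ x → toℕ x < toℕ r →
                 word π r < word π q → word π q < word π x → Role231or312 π x
  one-of-312   : ∀ {q r} → toℕ q < toℕ x → toℕ x < toℕ r →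
                 word π x < word π r → word π r < word π q → Role231or312 π x
  two-of-312   : ∀ {q r} → toℕ q < toℕ r → toℕ r < toℕ x →
                 word π r < word π x → word π x < word π q → Role231or312 π x

private
  module WithoutRole {n} (π : Permutation′ n) (3≤n : 3 ≤ n) (simple : IsSimple π) (x : Fin n)
                     (no-role : ¬ Role231or312 π x) where
    s : Fin n → ℕ
    s = word π

    X : ℕ
    X = toℕ x

    AboveUpTo : Fin n → Set
    AboveUpTo a = toℕ a ≤ X × (∀ q → toℕ a ≤ toℕ q → toℕ q < X → s x < s q)

    BelowFrom : Fin n → Set
    BelowFrom b = X ≤ toℕ b × (∀ r → X < toℕ r → toℕ r ≤ toℕ b → s r < s x)

    aboveUpTo? : Decidable AboveUpTo
    aboveUpTo? a = (toℕ a ≤? X)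
      ×-dec all? (λ q → (toℕ a ≤? toℕ q) →-dec ((toℕ q <? X) →-dec (s x <? s q)))

    belowFrom? : Decidable BelowFrom
    belowFrom? b = (X ≤? toℕ b)
      ×-dec all? (λ r → (X <? toℕ r) →-dec ((toℕ r ≤? toℕ b) →-dec (s r <? s x)))

    leftmost : ∃ λ a → AboveUpTo a × (∀ q → AboveUpTo q → toℕ a ≤ toℕ q)
    leftmost = argmin toℕ aboveUpTo? (x , ≤-refl , λ q x≤q q<x → contradiction q<x (≤⇒≯ x≤q))

    rightmost : ∃ λ b → BelowFrom b × (∀ r → BelowFrom r → toℕ r ≤ toℕ b)
    rightmost = argmax toℕ belowFrom? (x , ≤-refl , λ r x<r r≤x → contradiction x<r (≤⇒≯ r≤x))

    a b : Fin n
    a = proj₁ leftmost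
    b = proj₁ rightmost

    a≤x : toℕ a ≤ X
    a≤x = proj₁ (proj₁ (proj₂ leftmost))

    above-from-a : ∀ q → toℕ a ≤ toℕ q → toℕ q < X → s x < s q
    above-from-a = proj₂ (proj₁ (proj₂ leftmost))

    x≤b : X ≤ toℕ b
    x≤b = proj₁ (proj₁ (proj₂ rightmost))

    below-to-b : ∀ r → X < toℕ r → toℕ r ≤ toℕ b → s r < s x
    below-to-b = proj₂ (proj₁ (proj₂ rightmost))

    below-left-of-a : ∀ q → toℕ q < toℕ a → s q < s x
    below-left-of-a q q<a with s q <? s x
    ... | yes sq<sx = sq<sx
    ... | no  ≮ with any? (λ q′ → (toℕ q ≤? toℕ q′) ×-dec ((toℕ q′ <? X) ×-dec (s q′ <? s x)))
    ...   | yes (q′ , q≤q′ , q′<x , sq′<sx) = ⊥-elim (no-role (two-of-312 q<q′ q′<x sq′<sx sx<sq))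
      where
      sx<sq = word-≮⇒> π (<⇒≢ᶠ (<-≤-trans q<a a≤x)) ≮
      q<q′ = ≤∧≢⇒< q≤q′ λ q≡q′ → <-asym sq′<sx (subst (λ z → s x < s z) (toℕ-injective q≡q′) sx<sq)
    ...   | no  none = contradiction (proj₂ (proj₂ leftmost) q q-above) (<⇒≱ q<a)
      where
      q-above : AboveUpTo q
      q-above = <⇒≤ (<-≤-trans q<a a≤x) , λ q′ q≤q′ q′<x →
        word-≮⇒> π (<⇒≢ᶠ q′<x) λ sq′<sx → none (q′ , q≤q′ , q′<x , sq′<sx)

    above-right-of-b : ∀ r → toℕ b < toℕ r → s x < s r
    above-right-of-b r b<r with s x <? s r
    ... | yes sx<sr = sx<sr
    ... | no  ≮ with any? (λ r′ → (X <? toℕ r′) ×-dec ((toℕ r′ ≤? toℕ r) ×-dec (s x <? s r′)))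
    ...   | yes (r′ , x<r′ , r′≤r , sx<sr′) = ⊥-elim (no-role (two-of-231 x<r′ r′<r sr<sx sx<sr′))
      where
      sr<sx = word-≮⇒> π (λ x≡r → <⇒≢ᶠ (≤-<-trans x≤b b<r) x≡r) ≮
      r′<r = ≤∧≢⇒< r′≤r λ r′≡r →
        <-asym sx<sr′ (subst (λ z → s z < s x) (sym (toℕ-injective r′≡r)) sr<sx)
    ...   | no  none = contradiction (proj₂ (proj₂ rightmost) r r-below) (<⇒≱ b<r)
      where
      r-below : BelowFrom r
      r-below = <⇒≤ (≤-<-trans x≤b b<r) , λ r′ x<r′ r′≤r →
        word-≮⇒> π (λ x≡r′ → <⇒≢ᶠ x<r′ x≡r′) λ sx<sr′ → none (r′ , x<r′ , r′≤r , sx<sr′)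

    separated : Separated π a b
    separated q (inj₁ q<a) = inj₁ λ p (a≤p , p≤b) → below p a≤p p≤b
      where
      q<x = <-≤-trans q<a a≤x
      below : ∀ p → toℕ a ≤ toℕ p → toℕ p ≤ toℕ b → s q < s p
      below p a≤p p≤b with <-cmp (toℕ p) X
      ... | tri< p<x _ _ = <-trans (below-left-of-a q q<a) (above-from-a p a≤p p<x)
      ... | tri≈ _ p≡x _ = subst (λ z → s q < s z) (sym (toℕ-injective p≡x)) (below-left-of-a q q<a)
      ... | tri> _ _ x<p = word-≮⇒> π (λ p≡q → <⇒≢ᶠ (<-trans q<x x<p) (sym p≡q))
                             λ sp<sq → no-role (three-of-231 q<x x<p sp<sq (below-left-of-a q q<a))
    separated q (inj₂ b<q) = inj₂ λ p (a≤p , p≤b) → above p a≤p p≤b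
      where
      x<q = ≤-<-trans x≤b b<q
      above : ∀ p → toℕ a ≤ toℕ p → toℕ p ≤ toℕ b → s p < s q
      above p a≤p p≤b with <-cmp (toℕ p) X
      ... | tri< p<x _ _ = word-≮⇒> π (λ q≡p → <⇒≢ᶠ (<-trans p<x x<q) (sym q≡p))
                             λ sq<sp → no-role (one-of-312 p<x x<q (above-right-of-b q b<q) sq<sp)
      ... | tri≈ _ p≡x _ =
        subst (λ z → s z < s q) (sym (toℕ-injective p≡x)) (above-right-of-b q b<q)
      ... | tri> _ _ x<p = <-trans (below-to-b p x<p p≤b) (above-right-of-b q b<q)

    impossible : ⊥
    impossible with simple a b (separated⇒interval π (≤-trans a≤x x≤b) separated)
    ... | inj₁ a≡b =
      let (e , e+1<n , direct) = pivot⇒cut π {_<_} <-trans (<⇒≤ 3≤n) x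
            (λ q q<x → below-left-of-a q (<-≤-trans q<x (subst (X ≤_) (sym a≡b) x≤b)))
            (λ r x<r → above-right-of-b r (≤-<-trans (subst (_≤ X) a≡b a≤x) x<r))
      in simple⇒no-cut π simple 3≤n e+1<n (inj₁ direct)
    ... | inj₂ (a≡0 , b+1≡n) =
      let (e , e+1<n , skew) = pivot⇒cut π {_>_} (λ y>z z>w → <-trans z>w y>z) (<⇒≤ 3≤n) x
            (λ q q<x → above-from-a q (subst (_≤ toℕ q) (sym a≡0) z≤n) q<x)
            (λ r x<r → below-to-b r x<r (s≤s⁻¹ (subst (toℕ r <_) (sym b+1≡n) (toℕ<n r))))
      in simple⇒no-cut π simple 3≤n e+1<n (inj₂ skew)

simple⇒role : ∀ {n} (π : Permutation′ n) → 3 ≤ n → IsSimple π → ∀ x → ¬ ¬ Role231or312 π x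
simple⇒role π 3≤n simple x no-role = WithoutRole.impossible π 3≤n simple x no-role

data At {A : Set} : List A → ℕ → A → Set where
  here  : ∀ {x xs} → At (x ∷ xs) 0 x
  there : ∀ {x xs i v} → At xs i v → At (x ∷ xs) (suc i) v

module _ {A : Set} where

  At-lookup : ∀ (xs : List A) t → At xs (toℕ t) (lookup xs t)
  At-lookup (x ∷ xs) zero    = here
  At-lookup (x ∷ xs) (suc t) = there (At-lookup xs t)

  lookup-At : ∀ {xs : List A} {i v} → At xs i v → ∃ λ t → toℕ t ≡ i × lookup xs t ≡ v
  lookup-At here       = zero , refl , refl
  lookup-At (there at) = let (t , t≡i , xs[t]≡v) = lookup-At at in suc t , cong suc t≡i , xs[t]≡v

  At-++⁺ˡ : ∀ {xs ys : List A} {i v} → At xs i v → At (xs ++ ys) i v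
  At-++⁺ˡ here       = here
  At-++⁺ˡ (there at) = there (At-++⁺ˡ at)

  At-++⁺ʳ : ∀ (xs : List A) {ys i v} → At ys i v → At (xs ++ ys) (length xs + i) v
  At-++⁺ʳ []       at = at
  At-++⁺ʳ (x ∷ xs) at = there (At-++⁺ʳ xs at)

  At-++⁻ : ∀ (xs : List A) {ys i v} → At (xs ++ ys) i v →
    At xs i v ⊎ ∃ λ i′ → i ≡ length xs + i′ × At ys i′ v
  At-++⁻ []       at         = inj₂ (_ , refl , at)
  At-++⁻ (x ∷ xs) here       = inj₁ here
  At-++⁻ (x ∷ xs) (there at) with At-++⁻ xs at
  ... | inj₁ at′              = inj₁ (there at′)
  ... | inj₂ (i′ , i≡ , at′)  = inj₂ (i′ , cong suc i≡ , at′)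

  At-tabulate⁺ : ∀ {n} (f : Fin n → A) j → At (tabulate f) (toℕ j) (f j)
  At-tabulate⁺ f zero    = here
  At-tabulate⁺ f (suc j) = there (At-tabulate⁺ (f ∘ suc) j)

  At-tabulate⁻ : ∀ {n} (f : Fin n → A) {i v} → At (tabulate f) i v → ∃ λ j → toℕ j ≡ i × f j ≡ v
  At-tabulate⁻ {suc n} f here       = zero , refl , refl
  At-tabulate⁻ {suc n} f (there at) =
    let (j , j≡i , fj≡v) = At-tabulate⁻ (f ∘ suc) at in suc j , cong suc j≡i , fj≡v

blockStart : ∀ {m} → (Fin m → ℕ) → Fin m → ℕ
blockStart k zero    = 0
blockStart k (suc i) = k zero + blockStart (k ∘ suc) i

blockStart-mono : ∀ {m} (k : Fin m → ℕ) {i i′} → toℕ i < toℕ i′ →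
  blockStart k i + k i ≤ blockStart k i′
blockStart-mono k {zero}  {suc i′} _   = m≤m+n (k zero) _
blockStart-mono k {suc i} {suc i′} i<i′ = begin
  (k zero + blockStart (k ∘ suc) i) + k (suc i) ≡⟨ +-assoc (k zero) _ _ ⟩
  k zero + (blockStart (k ∘ suc) i + k (suc i))
    ≤⟨ +-monoʳ-≤ (k zero) (blockStart-mono (k ∘ suc) (s≤s⁻¹ i<i′)) ⟩
  k zero + blockStart (k ∘ suc) i′               ∎
  where open ≤-Reasoning

blockStart-< : ∀ {m} (k : Fin m → ℕ) {i i′} (j : Fin (k i)) (j′ : Fin (k i′)) → toℕ i < toℕ i′ →
  blockStart k i + toℕ j < blockStart k i′ + toℕ j′
blockStart-< k j j′ i<i′ =
  <-≤-trans (+-monoʳ-< _ (toℕ<n j)) (≤-trans (blockStart-mono k i<i′) (m≤m+n _ _))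

module _ {A : Set} where

  At-blocks⁺ : ∀ {m} (k : Fin m → ℕ) (g : (i : Fin m) → Fin (k i) → A) i j →
    At (concat (tabulate λ i → tabulate (g i))) (blockStart k i + toℕ j) (g i j)
  At-blocks⁺ k g zero    j = At-++⁺ˡ (At-tabulate⁺ (g zero) j)
  At-blocks⁺ k g (suc i) j =
    subst (λ z → At (concat (tabulate λ i → tabulate (g i))) z (g (suc i) j)) shift
      (At-++⁺ʳ (tabulate (g zero)) (At-blocks⁺ (k ∘ suc) (g ∘ suc) i j))
    where
    shift : length (tabulate (g zero)) + (blockStart (k ∘ suc) i + toℕ j)
          ≡ (k zero + blockStart (k ∘ suc) i) + toℕ j
    shift = trans (cong (_+ _) (length-tabulate (g zero))) (sym (+-assoc (k zero) _ _))

  At-blocks⁻ : ∀ {m} (k : Fin m → ℕ) (g : (i : Fin m) → Fin (k i) → A) {n v} →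
    At (concat (tabulate λ i → tabulate (g i))) n v →
    ∃₂ λ i j → n ≡ blockStart k i + toℕ j × g i j ≡ v
  At-blocks⁻ {suc m} k g at with At-++⁻ (tabulate (g zero)) at
  ... | inj₁ at₀ = let (j , j≡n , gj≡v) = At-tabulate⁻ (g zero) at₀ in zero , j , sym j≡n , gj≡v
  ... | inj₂ (n′ , n≡ , at′) =
    let (i , j , n′≡ , gij≡v) = At-blocks⁻ (k ∘ suc) (g ∘ suc) at′
    in suc i , j
     , trans n≡ (trans (cong₂ _+_ (length-tabulate (g zero)) n′≡) (sym (+-assoc (k zero) _ _)))
     , gij≡v

sum-map-mono : ∀ {A : Set} {f g : A → ℕ} → (∀ x → f x ≤ g x) →
  ∀ xs → sum (map f xs) ≤ sum (map g xs)
sum-map-mono f≤g []       = z≤n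
sum-map-mono f≤g (x ∷ xs) = +-mono-≤ (f≤g x) (sum-map-mono f≤g xs)

sum-map-mono-∈ : ∀ {A : Set} {f g : A → ℕ} {c x} → (∀ y → f y ≤ g y) → f x + c ≤ g x →
  ∀ {xs} → x ∈ xs → sum (map f xs) + c ≤ sum (map g xs)
sum-map-mono-∈ {f = f} {g} {c} {x} f≤g fx+c≤gx {x ∷ xs} (here refl) = begin
  (f x + sum (map f xs)) + c ≡⟨ +-assoc (f x) _ c ⟩
  f x + (sum (map f xs) + c) ≡⟨ cong (f x +_) (+-comm _ c) ⟩
  f x + (c + sum (map f xs)) ≡⟨ +-assoc (f x) c _ ⟨
  (f x + c) + sum (map f xs) ≤⟨ +-mono-≤ fx+c≤gx (sum-map-mono f≤g xs) ⟩
  g x + sum (map g xs)       ∎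
  where open ≤-Reasoning
sum-map-mono-∈ {f = f} {g} {c} f≤g fx+c≤gx {y ∷ xs} (there x∈xs) = begin
  (f y + sum (map f xs)) + c ≡⟨ +-assoc (f y) _ c ⟩
  f y + (sum (map f xs) + c) ≤⟨ +-mono-≤ (f≤g y) (sum-map-mono-∈ f≤g fx+c≤gx x∈xs) ⟩
  g y + sum (map g xs)       ∎
  where open ≤-Reasoning

offset-mono : ∀ {m} (σ : Permutation′ m) (k : Fin m → ℕ) {i i′} → word σ i < word σ i′ →
  offset σ k i + k i ≤ offset σ k i′
offset-mono {m} σ k {i} {i′} σi<σi′ = sum-map-mono-∈ below≤ i-counted (∈-allFin i)
  where
  counted : Fin m → Fin m → ℕ
  counted j l = if ⌊ word σ l <? word σ j ⌋ then k l else 0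
  below≤ : ∀ l → counted i l ≤ counted i′ l
  below≤ l with word σ l <? word σ i | word σ l <? word σ i′
  ... | yes _     | yes _   = ≤-refl
  ... | yes σl<σi | no  ≮   = contradiction (<-trans σl<σi σi<σi′) ≮
  ... | no  _     | _       = z≤n
  i-counted : counted i i + k i ≤ counted i′ i
  i-counted with word σ i <? word σ i | word σ i <? word σ i′
  ... | yes σi<σi | _     = contradiction σi<σi (<-irrefl refl)
  ... | no  _     | yes _ = ≤-refl
  ... | no  _     | no  ≮ = contradiction σi<σi′ ≮

-- `block` sends an entry of w to the entry of s whose inflation contains it.
record DecreasingInflation {L m} (w : Word L) (s : Word m) : Set where
  field
    block            : Fin L → Fin m
    block-monotone   : ∀ {t t′} → toℕ t < toℕ t′ → toℕ (block t) ≤ toℕ (block t′)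
    block-ordered    : ∀ {t t′} → s (block t) < s (block t′) → w t < w t′
    block-decreasing : ∀ {t t′} → block t ≡ block t′ → toℕ t < toℕ t′ → w t′ < w t

<-lit : ∀ {m n} {m<n : True (m <? n)} → m < n
<-lit {m<n = m<n} = toWitness m<n

module _ {L m} {w : Word L} {s : Word m} (s-injective : ∀ {i j} → s i ≡ s j → i ≡ j)
         (D : DecreasingInflation w s) where
  open DecreasingInflation D

  private
    ascent⇒later-block : ∀ {t t′} → toℕ t < toℕ t′ → w t < w t′ → toℕ (block t) < toℕ (block t′)
    ascent⇒later-block t<t′ wt<wt′ = ≤∧≢⇒< (block-monotone t<t′)
      λ same → <-asym wt<wt′ (block-decreasing (toℕ-injective same) t<t′)

    block-ordered⁻ : ∀ {t t′} → block t ≢ block t′ → w t < w t′ → s (block t) < s (block t′)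
    block-ordered⁻ {t} {t′} distinct wt<wt′ with <-cmp (s (block t)) (s (block t′))
    ... | tri< lt _ _ = lt
    ... | tri≈ _ eq _ = contradiction (s-injective eq) distinct
    ... | tri> _ _ gt = contradiction (block-ordered gt) (<⇒≯ wt<wt′)

    collapse : ∀ {k} {p : Word (suc k)} → Ranking p → ((f , _) : Contains p w) →
      Ascending (toℕ ∘ block ∘ f) → Contains p s
    collapse {p = p} R (f , _ , iso) blocks-ascending =
      contains-by-preservation {w = s} (Ranking.injective R) (block ∘ f) blocks-increasing
        λ a b pa<pb → block-ordered⁻ (different a b λ { refl → <-irrefl refl pa<pb })
                                     (Equivalence.to (iso a b) pa<pb)
      where
      blocks-increasing = ascending⇒increasing {h = toℕ ∘ block ∘ f} blocks-ascending
      different : ∀ a b → a ≢ b → block (f a) ≢ block (f b)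
      different a b a≢b same with <-cmp (toℕ a) (toℕ b)
      ... | tri< a<b _ _ = <-irrefl (cong toℕ same) (blocks-increasing a b a<b)
      ... | tri≈ _ a≡b _ = a≢b (toℕ-injective a≡b)
      ... | tri> _ _ b<a = <-irrefl (cong toℕ (sym same)) (blocks-increasing b a b<a)

  collapse-2341 : Contains p2341 w → Contains p2341 s
  collapse-2341 occ@(f , f-increasing , iso) =
    collapse ranking-2341 occ (ascending₄ {h = toℕ ∘ B} B₀<B₁ B₁<B₂ B₂<B₃)
    where
    w< : ∀ a b → p2341 a < p2341 b → w (f a) < w (f b)
    w< a b = Equivalence.to (iso a b)
    B : Fin 4 → Fin m
    B = block ∘ f
    B₀<B₁ = ascent⇒later-block (f-increasing (# 0) (# 1) <-lit) (w< (# 0) (# 1) <-lit)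
    B₁<B₂ = ascent⇒later-block (f-increasing (# 1) (# 2) <-lit) (w< (# 1) (# 2) <-lit)
    -- the 4 and the 1 cannot share a block: the 2 would then lie below the 1
    B₂<B₃ : toℕ (B (# 2)) < toℕ (B (# 3))
    B₂<B₃ = ≤∧≢⇒< (block-monotone (f-increasing (# 2) (# 3) <-lit)) λ same →
      <-asym (w< (# 3) (# 0) <-lit)
        (block-ordered (subst (λ z → s (B (# 0)) < s z) (toℕ-injective same)
          (block-ordered⁻ (λ eq → <-irrefl (cong toℕ eq) (<-trans B₀<B₁ B₁<B₂))
            (w< (# 0) (# 2) <-lit))))

  collapse-4123 : Contains p4123 w → Contains p4123 s
  collapse-4123 occ@(f , f-increasing , iso) =
    collapse ranking-4123 occ (ascending₄ {h = toℕ ∘ B} B₀<B₁ B₁<B₂ B₂<B₃)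
    where
    w< : ∀ a b → p4123 a < p4123 b → w (f a) < w (f b)
    w< a b = Equivalence.to (iso a b)
    B : Fin 4 → Fin m
    B = block ∘ f
    B₁<B₂ = ascent⇒later-block (f-increasing (# 1) (# 2) <-lit) (w< (# 1) (# 2) <-lit)
    B₂<B₃ = ascent⇒later-block (f-increasing (# 2) (# 3) <-lit) (w< (# 2) (# 3) <-lit)
    -- the 4 and the 1 cannot share a block: the 2 would then lie below the 1
    B₀<B₁ : toℕ (B (# 0)) < toℕ (B (# 1))
    B₀<B₁ = ≤∧≢⇒< (block-monotone (f-increasing (# 0) (# 1) <-lit)) λ same →
      let B₀<B₂ = subst (_< toℕ (B (# 2))) (sym same) B₁<B₂ in
      <-asym (w< (# 1) (# 2) <-lit)
        (block-ordered (subst (λ z → s (B (# 2)) < s z) (toℕ-injective same)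
          (block-ordered⁻ (λ eq → <-irrefl (cong toℕ (sym eq)) B₀<B₂) (w< (# 2) (# 0) <-lit))))

module Inflation {m} (σ : Permutation′ m) (k : Fin m → ℕ) (α : (i : Fin m) → Permutation′ (k i))
  where

  entry : (i : Fin m) → Fin (k i) → ℕ
  entry i j = offset σ k i + word (α i) j

  inflationList≡blocks : inflationList σ k α ≡ concat (tabulate λ i → tabulate (entry i))
  inflationList≡blocks = begin
    concat (map (λ i → map (entry i) (allFin (k i))) (allFin m))
      ≡⟨ cong concat (map-tabulate id (λ i → map (entry i) (allFin (k i)))) ⟩
    concat (tabulate λ i → map (entry i) (allFin (k i)))
      ≡⟨ cong concat (tabulate-cong λ i → map-tabulate id (entry i)) ⟩
    concat (tabulate λ i → tabulate (entry i)) ∎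
    where open ≡-Reasoning

  w : Word (length (inflationList σ k α))
  w = inflation σ k α

  private
    decompose : ∀ t → ∃₂ λ i j → toℕ t ≡ blockStart k i + toℕ j × w t ≡ entry i j
    decompose t =
      let (i , j , t≡ , entry≡) = At-blocks⁻ k entry
            (subst (λ xs → At xs (toℕ t) (w t)) inflationList≡blocks (At-lookup _ t))
      in i , j , t≡ , sym entry≡

    locate : ∀ i j → ∃ λ t → toℕ t ≡ blockStart k i + toℕ j × w t ≡ entry i j
    locate i j = lookup-At
      (subst (λ xs → At xs _ (entry i j)) (sym inflationList≡blocks) (At-blocks⁺ k entry i j))

  position : (i : Fin m) → Fin (k i) → Fin (length (inflationList σ k α))
  position i j = proj₁ (locate i j)

  toℕ-position : ∀ i j → toℕ (position i j) ≡ blockStart k i + toℕ j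
  toℕ-position i j = proj₁ (proj₂ (locate i j))

  w-position : ∀ i j → w (position i j) ≡ entry i j
  w-position i j = proj₂ (proj₂ (locate i j))

  entry-< : ∀ {i i′} (j : Fin (k i)) (j′ : Fin (k i′)) → word σ i < word σ i′ →
    entry i j < entry i′ j′
  entry-< {i} j j′ σi<σi′ = <-≤-trans (+-monoʳ-< (offset σ k i) (word<n (α i) j))
    (≤-trans (offset-mono σ k σi<σi′) (m≤m+n _ _))

  across-blocks : ∀ {i i′} {j : Fin (k i)} {j′ : Fin (k i′)} → toℕ i < toℕ i′ →
    toℕ (position i j) < toℕ (position i′ j′)
  across-blocks {i} {i′} {j} {j′} i<i′ =
    subst₂ _<_ (sym (toℕ-position i j)) (sym (toℕ-position i′ j′)) (blockStart-< k j j′ i<i′)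

  within-block : ∀ {i} {j j′ : Fin (k i)} → toℕ j < toℕ j′ →
    toℕ (position i j) < toℕ (position i j′)
  within-block {i} {j} {j′} j<j′ =
    subst₂ _<_ (sym (toℕ-position i j)) (sym (toℕ-position i j′)) (+-monoʳ-< (blockStart k i) j<j′)

  above-block : ∀ {i i′} {j : Fin (k i)} {j′ : Fin (k i′)} → word σ i < word σ i′ →
    w (position i j) < w (position i′ j′)
  above-block {i} {i′} {j} {j′} σi<σi′ =
    subst₂ _<_ (sym (w-position i j)) (sym (w-position i′ j′)) (entry-< j j′ σi<σi′)

  ascent-in-block : ∀ {i} {j j′ : Fin (k i)} → word (α i) j < word (α i) j′ →
    w (position i j) < w (position i j′)
  ascent-in-block {i} {j} {j′} αj<αj′ =
    subst₂ _<_ (sym (w-position i j)) (sym (w-position i j′)) (+-monoʳ-< (offset σ k i) αj<αj′)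

  private
    block : Fin (length (inflationList σ k α)) → Fin m
    block t = proj₁ (decompose t)

    toℕ-decompose : ∀ t → toℕ t ≡ blockStart k (block t) + toℕ (proj₁ (proj₂ (decompose t)))
    toℕ-decompose t = proj₁ (proj₂ (proj₂ (decompose t)))

    w-decompose : ∀ t → w t ≡ entry (block t) (proj₁ (proj₂ (decompose t)))
    w-decompose t = proj₂ (proj₂ (proj₂ (decompose t)))

  inflation-decreasing : (∀ i → IsDecreasing (α i)) → DecreasingInflation w (word σ)
  inflation-decreasing decreasing = record
    { block            = block
    ; block-monotone   = λ {t} {t′} t<t′ → ≮⇒≥ λ later<earlier → <-asym t<t′
        (subst₂ _<_ (sym (toℕ-decompose t′)) (sym (toℕ-decompose t))
          (blockStart-< k _ _ later<earlier))
    ; block-ordered    = λ {t} {t′} σ< →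
        subst₂ _<_ (sym (w-decompose t)) (sym (w-decompose t′)) (entry-< _ _ σ<)
    ; block-decreasing = λ {t} {t′} same t<t′ →
        subst₂ _<_ (sym (w-decompose t′)) (sym (w-decompose t))
          (descending same (subst₂ _<_ (toℕ-decompose t) (toℕ-decompose t′) t<t′))
    }
    where
    descending : ∀ {i i′} {j : Fin (k i)} {j′ : Fin (k i′)} → i ≡ i′ →
      blockStart k i + toℕ j < blockStart k i′ + toℕ j′ → entry i′ j′ < entry i j
    descending {i} refl start<start =
      +-monoʳ-< (offset σ k i) (decreasing i _ _ (+-cancelˡ-< (blockStart k i) _ _ start<start))

  module _ (nonempty : ∀ i → 1 ≤ k i) where
    private
      some : ∀ i → Fin (length (inflationList σ k α))
      some i = position i (fromℕ< (nonempty i))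

    role⇒contains : ∀ {x} → Role231or312 σ x → ∀ {j₁ j₂ : Fin (k x)} →
      toℕ j₁ < toℕ j₂ → word (α x) j₁ < word (α x) j₂ → Contains p2341 w ⊎ Contains p4123 w
    role⇒contains {x} (two-of-231 {q} {r} x<q q<r σr<σx σx<σq) {j₁} {j₂} j₁<j₂ ascent =
      inj₁ (contains₄ {w = w} ranking-2341
        (Vec.lookup (position x j₁ ∷ position x j₂ ∷ some q ∷ some r ∷ []))
        (within-block j₁<j₂) (across-blocks x<q) (across-blocks q<r)
        (above-block σr<σx) (ascent-in-block ascent) (above-block σx<σq))
    role⇒contains {x} (three-of-231 {q} {r} q<x x<r σr<σq σq<σx) {j₁} {j₂} j₁<j₂ ascent =
      inj₁ (contains₄ {w = w} ranking-2341
        (Vec.lookup (some q ∷ position x j₁ ∷ position x j₂ ∷ some r ∷ []))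
        (across-blocks q<x) (within-block j₁<j₂) (across-blocks x<r)
        (above-block σr<σq) (above-block σq<σx) (ascent-in-block ascent))
    role⇒contains {x} (one-of-312 {q} {r} q<x x<r σx<σr σr<σq) {j₁} {j₂} j₁<j₂ ascent =
      inj₂ (contains₄ {w = w} ranking-4123
        (Vec.lookup (some q ∷ position x j₁ ∷ position x j₂ ∷ some r ∷ []))
        (across-blocks q<x) (within-block j₁<j₂) (across-blocks x<r)
        (ascent-in-block ascent) (above-block σx<σr) (above-block σr<σq))
    role⇒contains {x} (two-of-312 {q} {r} q<r r<x σr<σx σx<σq) {j₁} {j₂} j₁<j₂ ascent =
      inj₂ (contains₄ {w = w} ranking-4123
        (Vec.lookup (some q ∷ some r ∷ position x j₁ ∷ position x j₂ ∷ []))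
        (across-blocks q<r) (across-blocks r<x) (within-block j₁<j₂)
        (above-block σr<σx) (ascent-in-block ascent) (above-block σx<σq))

proposition11 : (m : ℕ) → 4 ≤ m → (σ : Permutation′ m) → IsSimple σ →
    Avoids p2341 (word σ) → Avoids p4123 (word σ) →
    (k : Fin m → ℕ) → (∀ i → 1 ≤ k i) → (α : (i : Fin m) → Permutation′ (k i)) →
    ((Avoids p2341 (inflation σ k α) × Avoids p4123 (inflation σ k α))
      ⇔ (∀ i → IsDecreasing (α i)))
proposition11 m 4≤m σ simple σ-avoids-2341 σ-avoids-4123 k nonempty α = mk⇔ necessary sufficient
  where
  open Inflation σ k α

  sufficient : (∀ i → IsDecreasing (α i)) → Avoids p2341 w × Avoids p4123 w
  sufficient decreasing = σ-avoids-2341 ∘ collapse-2341 (word-injective σ) D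
                        , σ-avoids-4123 ∘ collapse-4123 (word-injective σ) D
    where D = inflation-decreasing decreasing

  necessary : Avoids p2341 w × Avoids p4123 w → ∀ i → IsDecreasing (α i)
  necessary (avoids-2341 , avoids-4123) i j₁ j₂ j₁<j₂ =
    decidable-stable (word (α i) j₂ <? word (α i) j₁) λ no-descent →
      simple⇒role σ (<⇒≤ 4≤m) simple i λ role →
        [ avoids-2341 , avoids-4123 ]′ (role⇒contains nonempty role j₁<j₂
          (word-≮⇒> (α i) (λ j₂≡j₁ → <⇒≢ᶠ j₁<j₂ (sym j₂≡j₁)) no-descent))
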